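{- Let $\mathbb K$ be a field of characteristic $0$, let $p\in\mathbb K$, let $f:\mathbb N\to\mathbb K$, and let $d\in\mathbb Z$ with $d\geq 0$. Then in the ring $\mathbb K[[x]]$ of formal power series $$\sum_{n=1}^\infty x^n\frac{(p)_n}{(n+d)!}\sum_{i=1}^n f(i)=\frac{(1-x)^{d-p}}{x^d}\int_0^x t^{d-1}(1-t)^{p-d-1}\sum_{n=1}^\infty t^n\frac{(p)_n}{(n+d-1)!}f(n)\,dt.$$
   Context: $(p)_n=p(p+1)\cdots(p+n-1)$ denotes the Pochhammer symbol. -}

module Defs where

open import Level using (Level; suc; _⊔_)
open import Data.Nat as ℕ using (ℕ; zero; _∸_; _<ᵇ_; _!)
  renaming (suc to 1+)
open import Data.Bool using (if_then_else_)
open import Relation.Nullary using (¬_)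
open import Algebra.Bundles using (CommutativeRing)

-- The inverse is a total operation whose
-- value on 0 is irrelevant (only its behaviour on nonzero elements is
-- constrained).
record Field (c ℓ : Level) : Set (suc (c ⊔ ℓ)) where
  field
    commutativeRing : CommutativeRing c ℓ
  open CommutativeRing commutativeRing public
  field
    _⁻¹       : Carrier → Carrier
    0≉1       : ¬ (0# ≈ 1#)
    ⁻¹-inverse : ∀ x → ¬ (x ≈ 0#) → (x * (x ⁻¹)) ≈ 1#

module FieldOps {c ℓ : Level} (F : Field c ℓ) where
  open Field F

  ι : ℕ → Carrier
  ι zero = 0#
  ι (1+ n) = 1# + ι n

  _/_ : Carrier → Carrier → Carrier
  a / b = a * (b ⁻¹)

  Σ< : ℕ → (ℕ → Carrier) → Carrier
  Σ< zero g = 0#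
  Σ< (1+ n) g = Σ< n g + g n

  Π< : ℕ → (ℕ → Carrier) → Carrier
  Π< zero g = 1#
  Π< (1+ n) g = Π< n g * g n

  poch : Carrier → ℕ → Carrier
  poch p n = Π< n (λ k → p + ι k)

  falling : Carrier → ℕ → Carrier
  falling a n = Π< n (λ k → a - ι k)

  fact : ℕ → Carrier
  fact n = ι (n !)

  sgn : ℕ → Carrier
  sgn zero = 1#
  sgn (1+ n) = - sgn n

CharZero : {c ℓ : Level} → Field c ℓ → Set ℓ
CharZero F = ∀ n → ¬ (ι (1+ n) ≈ 0#)
  where open Field F
        open FieldOps F

-- Formal power series over a field, represented by their coefficient
-- sequences (coefficient of x^n at index n).
module PowerSeries {c ℓ : Level} (F : Field c ℓ) where
  open Field F public
  open FieldOps F public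

  PS : Set c
  PS = ℕ → Carrier

  _≋_ : PS → PS → Set ℓ
  a ≋ b = ∀ n → a n ≈ b n

  _·_ : PS → PS → PS
  (a · b) n = Σ< (1+ n) (λ k → a k * b (n ∸ k))

  mulXPow : ℕ → PS → PS
  mulXPow d a n = if n <ᵇ d then 0# else a (n ∸ d)

  -- division by the monomial x^d (exact on series whose coefficients
  -- below degree d vanish, which is the case wherever it is used)
  divXPow : ℕ → PS → PS
  divXPow d a n = a (n ℕ.+ d)

  -- multiplication by t^(d-1) for d : ℕ (d = 0 meaning division by t)
  mulXPowPred : ℕ → PS → PS
  mulXPowPred d a = mulXPow d (divXPow 1 a)

  -- generalized binomial series (1 - x)^a = Σ_n (-1)^n C(a,n) x^n,
  -- with C(a,n) = a (a-1) ... (a-n+1) / n!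
  oneMinusXPow : Carrier → PS
  oneMinusXPow a n = sgn n * (falling a n / fact n)

  integral : PS → PS
  integral g zero = 0#
  integral g (1+ n) = g n / ι (1+ n)

  seriesFrom1 : (ℕ → Carrier) → PS
  seriesFrom1 c zero = 0#
  seriesFrom1 c (1+ n) = c (1+ n)

  sum1to : (ℕ → Carrier) → ℕ → Carrier
  sum1to f n = Σ< n (λ k → f (1+ k))

-- Write θ = x d/dx and, for b ∈ K, 𝓔_b Y = (1 - x)·θY + b·xY on K[[x]].
-- Coefficientwise (𝓔_b Y)_{n+1} = (n+1) Y_{n+1} - n Y_n + b Y_n, so in
-- characteristic 0 a solution of 𝓔_b Y = Z is determined by Y_0.  Moreover
-- 𝓔_b (1-x)^b = 0 and 𝓔_{a+b}(YZ) = (𝓔_a Y) Z + Y (𝓔_b Z).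
--
-- Let G be the left-hand side, H = Σ_{n≥1} x^n (p)_n/(n+d-1)! f(n) and
-- Q = (1-x)^{d-p} ∫ t^{d-1} (1-t)^{p-d-1} H(t) dt.  The coefficients of G obey
-- a first-order recurrence which reads 𝓔_{-p} G + d G = H, whence
-- 𝓔_{d-p}(x^d G) = x^d H.  Since θ∫ = x·, the Leibniz rule together with
-- (1-x)^{d-p} (1-x)^{p-d} = 1 gives 𝓔_{d-p} Q = x^d H as well.  Both Q and
-- x^d G have constant term 0, so Q = x^d G, which is the claim.

module Submission where

open import Defs
open import Data.Nat using (ℕ; _∸_) renaming (_+_ to _+ℕ_)
open import Level using (Level)
open import Data.Nat as ℕ using (zero) renaming (suc to 1+)
import Data.Nat.Properties as ℕP
open import Data.Integer as ℤ using (ℤ; +_; -[1+_])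
import Data.Integer.Properties as ℤP
open import Data.Maybe using (Maybe; just; nothing)
open import Relation.Nullary using (yes; no; ¬_)
open import Relation.Binary.PropositionalEquality as P using (_≡_)
open import Algebra.Bundles using (CommutativeRing)
import Algebra.Solver.Ring.AlmostCommutativeRing as ACR
import Algebra.Solver.Ring as RingSolver

-- The ring solver for an arbitrary commutative ring R, with integer
-- coefficients interpreted through the canonical map ℤ → R.
module IntegerCoefficients {c ℓ : Level} (R : CommutativeRing c ℓ) where
  open CommutativeRing R
  open import Algebra.Properties.Ring ring
    using (-‿distribˡ-*; -‿distribʳ-*; -‿involutive; -0#≈0#; -‿+-comm; -‿anti-homo-+; xyx⁻¹≈y)
  open import Algebra.Properties.Semiring.Mult.TCOptimised semiring using (_×_; 1+×; ×-cong; ×-homo-+; ×1-homo-*)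
  open import Relation.Binary.Reasoning.Setoid setoid

  -- The canonical ring homomorphism ℤ → R.  The optimised multiple _×_
  -- has 1 × 1# = 1#, so that the coefficient 1 evaluates to 1# itself.
  ⟦_⟧ : ℤ → Carrier
  ⟦ + n ⟧ = n × 1#
  ⟦ -[1+ n ] ⟧ = - (1+ n × 1#)

  ⟦⟧-neg : ∀ i → ⟦ ℤ.- i ⟧ ≈ - ⟦ i ⟧
  ⟦⟧-neg -[1+ n ] = sym (-‿involutive _)
  ⟦⟧-neg (+ zero) = sym -0#≈0#
  ⟦⟧-neg (+ 1+ n) = refl

  cancel-1+ : ∀ a b → (1# + a) - (1# + b) ≈ a - b
  cancel-1+ a b = begin
    (1# + a) + - (1# + b)      ≈⟨ +-congˡ (-‿anti-homo-+ 1# b) ⟩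
    (1# + a) + (- b + - 1#)    ≈⟨ sym (+-assoc _ _ _) ⟩
    ((1# + a) + - b) + - 1#    ≈⟨ +-congʳ (+-assoc _ _ _) ⟩
    (1# + (a - b)) + - 1#      ≈⟨ xyx⁻¹≈y 1# (a - b) ⟩
    a - b                      ∎

  ⟦⟧-⊖ : ∀ m n → ⟦ m ℤ.⊖ n ⟧ ≈ m × 1# - n × 1#
  ⟦⟧-⊖ m zero = P.subst (λ i → ⟦ i ⟧ ≈ m × 1# - 0#) (P.sym (ℤP.⊖-≥ {m} {0} ℕ.z≤n))
                  (sym (trans (+-congˡ -0#≈0#) (+-identityʳ _)))
  ⟦⟧-⊖ zero (1+ n) = sym (+-identityˡ _)
  ⟦⟧-⊖ (1+ m) (1+ n) = P.subst (λ i → ⟦ i ⟧ ≈ 1+ m × 1# - 1+ n × 1#) (P.sym (ℤP.[1+m]⊖[1+n]≡m⊖n m n))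
                         (trans (⟦⟧-⊖ m n) (sym (trans (+-cong (1+× m 1#) (-‿cong (1+× n 1#))) (cancel-1+ _ _))))

  ⟦⟧-+ : ∀ i j → ⟦ i ℤ.+ j ⟧ ≈ ⟦ i ⟧ + ⟦ j ⟧
  ⟦⟧-+ -[1+ m ] -[1+ n ] = begin
    - (1+ (1+ (m +ℕ n)) × 1#)       ≈⟨ -‿cong (×-cong (P.sym (ℕP.+-suc (1+ m) n)) refl) ⟩
    - ((1+ m +ℕ 1+ n) × 1#)         ≈⟨ -‿cong (×-homo-+ 1# (1+ m) (1+ n)) ⟩
    - (1+ m × 1# + 1+ n × 1#)       ≈⟨ sym (-‿+-comm _ _) ⟩
    - (1+ m × 1#) + - (1+ n × 1#)   ∎
  ⟦⟧-+ -[1+ m ] (+ n) = trans (⟦⟧-⊖ n (1+ m)) (+-comm _ _)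
  ⟦⟧-+ (+ m) -[1+ n ] = ⟦⟧-⊖ m (1+ n)
  ⟦⟧-+ (+ m) (+ n) = ×-homo-+ 1# m n

  neg*neg : ∀ x y → - x * - y ≈ x * y
  neg*neg x y = begin
    - x * - y       ≈⟨ sym (-‿distribʳ-* (- x) y) ⟩
    - (- x * y)     ≈⟨ -‿cong (sym (-‿distribˡ-* x y)) ⟩
    - - (x * y)     ≈⟨ -‿involutive _ ⟩
    x * y           ∎

  ⟦⟧-*⁺ : ∀ m n → ⟦ + m ℤ.* + n ⟧ ≈ ⟦ + m ⟧ * ⟦ + n ⟧
  ⟦⟧-*⁺ m n = P.subst (λ i → ⟦ i ⟧ ≈ m × 1# * n × 1#) (ℤP.pos-* m n) (×1-homo-* m n)

  ⟦⟧-* : ∀ i j → ⟦ i ℤ.* j ⟧ ≈ ⟦ i ⟧ * ⟦ j ⟧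
  ⟦⟧-* (+ m) (+ n) = ⟦⟧-*⁺ m n
  ⟦⟧-* (+ m) -[1+ n ] =
    P.subst (λ i → ⟦ i ⟧ ≈ ⟦ + m ⟧ * ⟦ -[1+ n ] ⟧) (ℤP.neg-distribʳ-* (+ m) (+ 1+ n))
      (trans (⟦⟧-neg (+ m ℤ.* + 1+ n)) (trans (-‿cong (⟦⟧-*⁺ m (1+ n))) (-‿distribʳ-* _ _)))
  ⟦⟧-* -[1+ m ] (+ n) =
    P.subst (λ i → ⟦ i ⟧ ≈ ⟦ -[1+ m ] ⟧ * ⟦ + n ⟧) (ℤP.neg-distribˡ-* (+ 1+ m) (+ n))
      (trans (⟦⟧-neg (+ 1+ m ℤ.* + n)) (trans (-‿cong (⟦⟧-*⁺ (1+ m) n)) (-‿distribˡ-* _ _)))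
  ⟦⟧-* -[1+ m ] -[1+ n ] = trans (⟦⟧-*⁺ (1+ m) (1+ n)) (sym (neg*neg _ _))

  homomorphism : CommutativeRing.rawRing ℤP.+-*-commutativeRing
                   ACR.-Raw-AlmostCommutative⟶ ACR.fromCommutativeRing R
  homomorphism = record
    { ⟦_⟧ = ⟦_⟧ ; +-homo = ⟦⟧-+ ; *-homo = ⟦⟧-* ; -‿homo = ⟦⟧-neg
    ; 0-homo = refl ; 1-homo = refl }

  ⟦⟧-≟ : ∀ i j → Maybe (⟦ i ⟧ ≈ ⟦ j ⟧)
  ⟦⟧-≟ i j with i ℤ.≟ j
  ... | yes P.refl = just refl
  ... | no _ = nothing

  open RingSolver _ _ homomorphism ⟦⟧-≟ public using (solve; _:=_; _:+_; _:*_; _:-_; :-_; con)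

module SeriesAlgebra {c ℓ : Level} (F : Field c ℓ) where
  open PowerSeries F
  open IntegerCoefficients commutativeRing using (solve; _:=_; _:+_; _:*_; _:-_; :-_; con)
  open import Algebra.Properties.Ring ring using (-‿distribˡ-*; -‿distribʳ-*; -0#≈0#; -‿+-comm)
  open import Algebra.Properties.Semiring.Mult.TCOptimised semiring using (_×_; 1+×; ×-homo-+; ×1-homo-*)
  open import Algebra.Properties.CommutativeSemigroup +-commutativeSemigroup using (interchange)
  open import Algebra.Properties.CommutativeSemigroup *-commutativeSemigroup using (x∙yz≈y∙xz)
  open import Relation.Binary.Reasoning.Setoid setoid

  ι≈×1 : ∀ n → ι n ≈ n × 1#
  ι≈×1 zero = refl
  ι≈×1 (1+ n) = trans (+-congˡ (ι≈×1 n)) (sym (1+× n 1#))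

  ι-+ : ∀ m n → ι (m +ℕ n) ≈ ι m + ι n
  ι-+ m n = trans (ι≈×1 (m +ℕ n)) (trans (×-homo-+ 1# m n) (sym (+-cong (ι≈×1 m) (ι≈×1 n))))

  ι-* : ∀ m n → ι (m ℕ.* n) ≈ ι m * ι n
  ι-* m n = trans (ι≈×1 (m ℕ.* n)) (trans (×1-homo-* m n) (sym (*-cong (ι≈×1 m) (ι≈×1 n))))

  Σ-cong : ∀ n {g h : ℕ → Carrier} → (∀ k → k ℕ.< n → g k ≈ h k) → Σ< n g ≈ Σ< n h
  Σ-cong zero e = refl
  Σ-cong (1+ n) e = +-cong (Σ-cong n (λ k k<n → e k (ℕP.m<n⇒m<1+n k<n))) (e n (ℕP.n<1+n n))

  Σ-+ : ∀ n (g h : ℕ → Carrier) → Σ< n (λ k → g k + h k) ≈ Σ< n g + Σ< n h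
  Σ-+ zero g h = sym (+-identityˡ _)
  Σ-+ (1+ n) g h = trans (+-congʳ (Σ-+ n g h)) (interchange _ _ _ _)

  Σ-neg : ∀ n (g : ℕ → Carrier) → Σ< n (λ k → - g k) ≈ - Σ< n g
  Σ-neg zero g = sym -0#≈0#
  Σ-neg (1+ n) g = trans (+-congʳ (Σ-neg n g)) (-‿+-comm _ _)

  Σ-*ˡ : ∀ n a (g : ℕ → Carrier) → Σ< n (λ k → a * g k) ≈ a * Σ< n g
  Σ-*ˡ zero a g = sym (zeroʳ _)
  Σ-*ˡ (1+ n) a g = trans (+-congʳ (Σ-*ˡ n a g)) (sym (distribˡ _ _ _))

  Σ-zero : ∀ n {g : ℕ → Carrier} → (∀ k → k ℕ.< n → g k ≈ 0#) → Σ< n g ≈ 0#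
  Σ-zero zero e = refl
  Σ-zero (1+ n) e = trans (+-cong (Σ-zero n (λ k k<n → e k (ℕP.m<n⇒m<1+n k<n))) (e n (ℕP.n<1+n n)))
                          (+-identityʳ 0#)

  Σ-peel : ∀ n (g : ℕ → Carrier) → Σ< (1+ n) g ≈ g 0 + Σ< n (λ k → g (1+ k))
  Σ-peel zero g = trans (+-identityˡ _) (sym (+-identityʳ _))
  Σ-peel (1+ n) g = trans (+-congʳ (Σ-peel n g)) (+-assoc _ _ _)

  infixl 6 _⊕_ _⊝_
  infixr 7 _⊛_

  _⊕_ : PS → PS → PS
  (Y ⊕ Z) n = Y n + Z n

  _⊝_ : PS → PS → PS
  (Y ⊝ Z) n = Y n - Z n

  _⊛_ : Carrier → PS → PS
  (a ⊛ Y) n = a * Y n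

  𝟘 : PS
  𝟘 n = 0#

  𝟙 : PS
  𝟙 zero = 1#
  𝟙 (1+ n) = 0#

  shift : PS → PS
  shift Y zero = 0#
  shift Y (1+ n) = Y n

  shift^ : ℕ → PS → PS
  shift^ zero Y = Y
  shift^ (1+ d) Y = shift (shift^ d Y)

  [1-x] : PS → PS
  [1-x] Y = Y ⊝ shift Y

  θ : PS → PS
  θ Y n = ι n * Y n

  tail : PS → PS
  tail Y n = Y (1+ n)

  ≋-sym : ∀ {Y Z} → Y ≋ Z → Z ≋ Y
  ≋-sym e n = sym (e n)

  ≋-trans : ∀ {X Y Z} → X ≋ Y → Y ≋ Z → X ≋ Z
  ≋-trans e e' n = trans (e n) (e' n)

  shift-cong : ∀ {Y Z} → Y ≋ Z → shift Y ≋ shift Z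
  shift-cong e zero = refl
  shift-cong e (1+ n) = e n

  shift^-cong : ∀ d {Y Z} → Y ≋ Z → shift^ d Y ≋ shift^ d Z
  shift^-cong zero e = e
  shift^-cong (1+ d) e = shift-cong (shift^-cong d e)

  [1-x]-cong : ∀ {Y Z} → Y ≋ Z → [1-x] Y ≋ [1-x] Z
  [1-x]-cong e n = +-cong (e n) (-‿cong (shift-cong e n))

  [1-x]-𝟘 : ∀ {Y} → Y ≋ 𝟘 → [1-x] Y ≋ 𝟘
  [1-x]-𝟘 e zero = trans (+-cong (e 0) -0#≈0#) (+-identityʳ 0#)
  [1-x]-𝟘 e (1+ n) = trans (+-cong (e (1+ n)) (trans (-‿cong (e n)) -0#≈0#)) (+-identityʳ 0#)

  shift-⊕ : ∀ Y Z → shift (Y ⊕ Z) ≋ (shift Y ⊕ shift Z)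
  shift-⊕ Y Z zero = sym (+-identityʳ 0#)
  shift-⊕ Y Z (1+ n) = refl

  shift-⊝ : ∀ Y Z → shift (Y ⊝ Z) ≋ (shift Y ⊝ shift Z)
  shift-⊝ Y Z zero = sym (trans (+-congˡ -0#≈0#) (+-identityʳ 0#))
  shift-⊝ Y Z (1+ n) = refl

  ·-congˡ : ∀ {Y Y'} Z → Y ≋ Y' → (Y · Z) ≋ (Y' · Z)
  ·-congˡ Z e n = Σ-cong (1+ n) (λ k _ → *-congʳ (e k))

  ·-congʳ : ∀ Y {Z Z'} → Z ≋ Z' → (Y · Z) ≋ (Y · Z')
  ·-congʳ Y e n = Σ-cong (1+ n) (λ k _ → *-congˡ (e (n ∸ k)))

  ·-distribʳ-⊕ : ∀ Y Z W → ((Y ⊕ Z) · W) ≋ ((Y · W) ⊕ (Z · W))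
  ·-distribʳ-⊕ Y Z W n = trans (Σ-cong (1+ n) (λ k _ → distribʳ _ _ _)) (Σ-+ (1+ n) _ _)

  ·-distribˡ-⊕ : ∀ W Y Z → (W · (Y ⊕ Z)) ≋ ((W · Y) ⊕ (W · Z))
  ·-distribˡ-⊕ W Y Z n = trans (Σ-cong (1+ n) (λ k _ → distribˡ _ _ _)) (Σ-+ (1+ n) _ _)

  ·-distribʳ-⊝ : ∀ Y Z W → ((Y ⊝ Z) · W) ≋ ((Y · W) ⊝ (Z · W))
  ·-distribʳ-⊝ Y Z W n =
    trans (Σ-cong (1+ n) (λ k _ → trans (distribʳ _ _ _) (+-congˡ (sym (-‿distribˡ-* _ _)))))
          (trans (Σ-+ (1+ n) _ _) (+-congˡ (Σ-neg (1+ n) _)))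

  ·-distribˡ-⊝ : ∀ W Y Z → (W · (Y ⊝ Z)) ≋ ((W · Y) ⊝ (W · Z))
  ·-distribˡ-⊝ W Y Z n =
    trans (Σ-cong (1+ n) (λ k _ → trans (distribˡ _ _ _) (+-congˡ (sym (-‿distribʳ-* _ _)))))
          (trans (Σ-+ (1+ n) _ _) (+-congˡ (Σ-neg (1+ n) _)))

  ·-⊛ˡ : ∀ a Y W → ((a ⊛ Y) · W) ≋ (a ⊛ (Y · W))
  ·-⊛ˡ a Y W n = trans (Σ-cong (1+ n) (λ k _ → *-assoc _ _ _)) (Σ-*ˡ (1+ n) a _)

  ·-⊛ʳ : ∀ a Y W → (Y · (a ⊛ W)) ≋ (a ⊛ (Y · W))
  ·-⊛ʳ a Y W n = trans (Σ-cong (1+ n) (λ k _ → x∙yz≈y∙xz _ _ _)) (Σ-*ˡ (1+ n) a _)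

  ·-shiftˡ : ∀ Y W → (shift Y · W) ≋ shift (Y · W)
  ·-shiftˡ Y W zero = trans (+-identityˡ _) (zeroˡ _)
  ·-shiftˡ Y W (1+ m) = trans (Σ-peel (1+ m) _) (trans (+-congʳ (zeroˡ _)) (+-identityˡ _))

  ·-shiftʳ : ∀ Y W → (Y · shift W) ≋ shift (Y · W)
  ·-shiftʳ Y W zero = trans (+-identityˡ _) (zeroʳ _)
  ·-shiftʳ Y W (1+ m) = begin
    Σ< (1+ m) (λ k → Y k * shift W (1+ m ∸ k)) + Y (1+ m) * shift W (m ∸ m)
      ≈⟨ +-cong (Σ-cong (1+ m) (λ k k<1+m → *-congˡ (inner k k<1+m))) (*-congˡ last) ⟩
    Σ< (1+ m) (λ k → Y k * W (m ∸ k)) + Y (1+ m) * 0#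
      ≈⟨ trans (+-congˡ (zeroʳ _)) (+-identityʳ _) ⟩
    Σ< (1+ m) (λ k → Y k * W (m ∸ k)) ∎
    where
    inner : ∀ k → k ℕ.< 1+ m → shift W (1+ m ∸ k) ≈ W (m ∸ k)
    inner k (ℕ.s≤s k≤m) rewrite ℕP.+-∸-assoc 1 k≤m = refl
    last : shift W (m ∸ m) ≈ 0#
    last rewrite ℕP.n∸n≡0 m = refl

  ·-identityˡ : ∀ W → (𝟙 · W) ≋ W
  ·-identityˡ W n =
    trans (Σ-peel n _) (trans (+-cong (*-identityˡ _) (Σ-zero n (λ k _ → zeroˡ _))) (+-identityʳ _))

  ·-zeroˡ : ∀ {Y} W → Y ≋ 𝟘 → (Y · W) ≋ 𝟘
  ·-zeroˡ W e n = Σ-zero (1+ n) (λ k _ → trans (*-congʳ (e k)) (zeroˡ _))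

  ·-zeroʳ : ∀ Y {W} → W ≋ 𝟘 → (Y · W) ≋ 𝟘
  ·-zeroʳ Y e n = Σ-zero (1+ n) (λ k _ → trans (*-congˡ (e (n ∸ k))) (zeroʳ _))

  [1-x]-·ˡ : ∀ Y Z → ([1-x] Y · Z) ≋ [1-x] (Y · Z)
  [1-x]-·ˡ Y Z n = trans (·-distribʳ-⊝ Y (shift Y) Z n) (+-congˡ (-‿cong (·-shiftˡ Y Z n)))

  [1-x]-·ʳ : ∀ Y Z → (Y · [1-x] Z) ≋ [1-x] (Y · Z)
  [1-x]-·ʳ Y Z n = trans (·-distribˡ-⊝ Y Z (shift Z) n) (+-congˡ (-‿cong (·-shiftʳ Y Z n)))

  -- Associativity, by induction on the degree using Y = Y₀ + x·tail Y.
  ·-peel : ∀ Y V → (Y · V) ≋ (Y 0 ⊛ V ⊕ shift (tail Y · V))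
  ·-peel Y V zero = trans (+-identityˡ _) (sym (+-identityʳ _))
  ·-peel Y V (1+ n) = Σ-peel (1+ n) _

  ·-assoc : ∀ Y Z W → ((Y · Z) · W) ≋ (Y · (Z · W))
  ·-assoc Y Z W n = begin
    ((Y · Z) · W) n                                    ≈⟨ ·-congˡ W (·-peel Y Z) n ⟩
    ((Y 0 ⊛ Z ⊕ shift (tail Y · Z)) · W) n              ≈⟨ ·-distribʳ-⊕ _ _ W n ⟩
    ((Y 0 ⊛ Z) · W) n + (shift (tail Y · Z) · W) n      ≈⟨ +-cong (·-⊛ˡ (Y 0) Z W n) (·-shiftˡ _ W n) ⟩
    Y 0 * (Z · W) n + shift ((tail Y · Z) · W) n       ≈⟨ +-congˡ (shifted n) ⟩
    Y 0 * (Z · W) n + shift (tail Y · (Z · W)) n       ≈⟨ sym (·-peel Y (Z · W) n) ⟩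
    (Y · (Z · W)) n                                    ∎
    where
    shifted : shift ((tail Y · Z) · W) ≋ shift (tail Y · (Z · W))
    shifted zero = refl
    shifted (1+ m) = ·-assoc (tail Y) Z W m

  θ-Leibniz : ∀ Y Z → θ (Y · Z) ≋ ((θ Y · Z) ⊕ (Y · θ Z))
  θ-Leibniz Y Z n = begin
    ι n * Σ< (1+ n) (λ k → Y k * Z (n ∸ k))                  ≈⟨ sym (Σ-*ˡ (1+ n) (ι n) _) ⟩
    Σ< (1+ n) (λ k → ι n * (Y k * Z (n ∸ k)))                ≈⟨ Σ-cong (1+ n) term ⟩
    Σ< (1+ n) (λ k → (ι k * Y k) * Z (n ∸ k) + Y k * (ι (n ∸ k) * Z (n ∸ k)))
                                                             ≈⟨ Σ-+ (1+ n) _ _ ⟩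
    (θ Y · Z) n + (Y · θ Z) n                                ∎
    where
    split : ∀ a b y z → (a + b) * (y * z) ≈ (a * y) * z + y * (b * z)
    split = solve 4 (λ a b y z → (a :+ b) :* (y :* z) := (a :* y) :* z :+ y :* (b :* z)) refl
    term : ∀ k → k ℕ.< 1+ n → ι n * (Y k * Z (n ∸ k)) ≈ (ι k * Y k) * Z (n ∸ k) + Y k * (ι (n ∸ k) * Z (n ∸ k))
    term k (ℕ.s≤s k≤n) = trans (*-congʳ (trans (reflexive (P.cong ι (P.sym (ℕP.m+[n∸m]≡n k≤n))))
                                                (ι-+ k (n ∸ k)))) (split _ _ _ _)

  mulXPow≋shift^ : ∀ d Y → mulXPow d Y ≋ shift^ d Y
  mulXPow≋shift^ zero Y n = refl
  mulXPow≋shift^ (1+ d) Y zero = refl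
  mulXPow≋shift^ (1+ d) Y (1+ n) = mulXPow≋shift^ d Y n

  shift-divX : ∀ Y → Y 0 ≈ 0# → shift (divXPow 1 Y) ≋ Y
  shift-divX Y Y₀≈0 zero = sym Y₀≈0
  shift-divX Y Y₀≈0 (1+ m) = reflexive (P.cong Y (ℕP.+-comm m 1))

  shift^-at : ∀ d Y n → shift^ d Y (d +ℕ n) ≡ Y n
  shift^-at zero Y n = P.refl
  shift^-at (1+ d) Y n = shift^-at d Y n

  shift^-constant : ∀ d {Y} → Y 0 ≈ 0# → shift^ d Y 0 ≈ 0#
  shift^-constant zero e = e
  shift^-constant (1+ d) e = refl

  shift^-shift : ∀ d Y → shift^ d (shift Y) ≋ shift (shift^ d Y)
  shift^-shift zero Y n = refl
  shift^-shift (1+ d) Y = shift-cong (shift^-shift d Y)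

  shift^-⊕ : ∀ d Y Z → shift^ d (Y ⊕ Z) ≋ (shift^ d Y ⊕ shift^ d Z)
  shift^-⊕ zero Y Z n = refl
  shift^-⊕ (1+ d) Y Z = ≋-trans (shift-cong (shift^-⊕ d Y Z)) (shift-⊕ _ _)

  shift^-⊝ : ∀ d Y Z → shift^ d (Y ⊝ Z) ≋ (shift^ d Y ⊝ shift^ d Z)
  shift^-⊝ zero Y Z n = refl
  shift^-⊝ (1+ d) Y Z = ≋-trans (shift-cong (shift^-⊝ d Y Z)) (shift-⊝ _ _)

  ·-shift^ʳ : ∀ d Y W → (Y · shift^ d W) ≋ shift^ d (Y · W)
  ·-shift^ʳ zero Y W n = refl
  ·-shift^ʳ (1+ d) Y W = ≋-trans (·-shiftʳ Y (shift^ d W)) (shift-cong (·-shift^ʳ d Y W))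

  [1-x]-shift^ : ∀ d Y → [1-x] (shift^ d Y) ≋ shift^ d ([1-x] Y)
  [1-x]-shift^ d Y n =
    trans (+-congˡ (-‿cong (sym (shift^-shift d Y n)))) (sym (shift^-⊝ d Y (shift Y) n))

  𝓔 : Carrier → PS → PS
  𝓔 b Y = [1-x] (θ Y) ⊕ b ⊛ shift Y

  𝓔-congˡ : ∀ {a b} Y → a ≈ b → 𝓔 a Y ≋ 𝓔 b Y
  𝓔-congˡ Y e n = +-congˡ (*-congʳ e)

  𝓔-·ˡ : ∀ a Y Z → (𝓔 a Y · Z) ≋ ([1-x] (θ Y · Z) ⊕ a ⊛ shift (Y · Z))
  𝓔-·ˡ a Y Z n = trans (·-distribʳ-⊕ ([1-x] (θ Y)) (a ⊛ shift Y) Z n)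
    (+-cong ([1-x]-·ˡ (θ Y) Z n) (trans (·-⊛ˡ a (shift Y) Z n) (*-congˡ (·-shiftˡ Y Z n))))

  𝓔-·ʳ : ∀ b Y Z → (Y · 𝓔 b Z) ≋ ([1-x] (Y · θ Z) ⊕ b ⊛ shift (Y · Z))
  𝓔-·ʳ b Y Z n = trans (·-distribˡ-⊕ Y ([1-x] (θ Z)) (b ⊛ shift Z) n)
    (+-cong ([1-x]-·ʳ Y (θ Z) n) (trans (·-⊛ʳ b Y (shift Z) n) (*-congˡ (·-shiftʳ Y Z n))))

  𝓔-Leibniz : ∀ a b Y Z → 𝓔 (a + b) (Y · Z) ≋ ((𝓔 a Y · Z) ⊕ (Y · 𝓔 b Z))
  𝓔-Leibniz a b Y Z n = begin
    𝓔 (a + b) (Y · Z) n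
      ≈⟨ +-congʳ ([1-x]-cong (θ-Leibniz Y Z) n) ⟩
    ((U n + V n) - shift (U ⊕ V) n) + (a + b) * shift (Y · Z) n
      ≈⟨ +-congʳ (+-congˡ (-‿cong (shift-⊕ U V n))) ⟩
    ((U n + V n) - (shift U n + shift V n)) + (a + b) * shift (Y · Z) n
      ≈⟨ regroup _ _ _ _ _ _ _ ⟩
    ([1-x] U n + a * shift (Y · Z) n) + ([1-x] V n + b * shift (Y · Z) n)
      ≈⟨ sym (+-cong (𝓔-·ˡ a Y Z n) (𝓔-·ʳ b Y Z n)) ⟩
    (𝓔 a Y · Z) n + (Y · 𝓔 b Z) n ∎
    where
    U = θ Y · Z
    V = Y · θ Z
    regroup : ∀ u v u' v' a b s → ((u + v) - (u' + v')) + (a + b) * s ≈ ((u - u') + a * s) + ((v - v') + b * s)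
    regroup = solve 7 (λ u v u' v' a b s → ((u :+ v) :- (u' :+ v')) :+ (a :+ b) :* s
                         := ((u :- u') :+ a :* s) :+ ((v :- v') :+ b :* s)) refl

  𝓔-shift : ∀ b Y → 𝓔 (b + 1#) (shift Y) ≋ shift (𝓔 b Y ⊕ Y)
  𝓔-shift b Y zero = at0 b
    where
    at0 : ∀ b → (0# * 0# - 0#) + (b + 1#) * 0# ≈ 0#
    at0 = solve 1 (λ b → (con (+ 0) :* con (+ 0) :- con (+ 0)) :+ (b :+ con (+ 1)) :* con (+ 0)
                     := con (+ 0)) refl
  𝓔-shift b Y (1+ zero) = at1 (Y 0) b
    where
    at1 : ∀ y b → ((1# + 0#) * y - 0# * 0#) + (b + 1#) * 0# ≈ ((0# * y - 0#) + b * 0#) + y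
    at1 = solve 2 (λ y b → ((con (+ 1) :+ con (+ 0)) :* y :- con (+ 0) :* con (+ 0)) :+ (b :+ con (+ 1)) :* con (+ 0)
                     := ((con (+ 0) :* y :- con (+ 0)) :+ b :* con (+ 0)) :+ y) refl
  𝓔-shift b Y (1+ (1+ k)) = step (ι k) (Y (1+ k)) (Y k) b
    where
    step : ∀ x y₁ y₀ b → ((1# + (1# + x)) * y₁ - (1# + x) * y₀) + (b + 1#) * y₀
                         ≈ (((1# + x) * y₁ - x * y₀) + b * y₀) + y₁
    step = solve 4 (λ x y₁ y₀ b → ((con (+ 1) :+ (con (+ 1) :+ x)) :* y₁ :- (con (+ 1) :+ x) :* y₀) :+ (b :+ con (+ 1)) :* y₀
                     := (((con (+ 1) :+ x) :* y₁ :- x :* y₀) :+ b :* y₀) :+ y₁) refl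

  𝓔-shift^ : ∀ b d Y → 𝓔 (b + ι d) (shift^ d Y) ≋ shift^ d (𝓔 b Y ⊕ ι d ⊛ Y)
  𝓔-shift^ b zero Y n = trans (𝓔-congˡ Y (+-identityʳ b) n) (sym (trans (+-congˡ (zeroˡ _)) (+-identityʳ _)))
  𝓔-shift^ b (1+ d) Y n = begin
    𝓔 (b + (1# + ι d)) (shift (shift^ d Y)) n
      ≈⟨ 𝓔-congˡ _ (reassoc b (ι d)) n ⟩
    𝓔 ((b + ι d) + 1#) (shift (shift^ d Y)) n
      ≈⟨ 𝓔-shift (b + ι d) (shift^ d Y) n ⟩
    shift (𝓔 (b + ι d) (shift^ d Y) ⊕ shift^ d Y) n
      ≈⟨ shift-cong (λ m → +-congʳ (𝓔-shift^ b d Y m)) n ⟩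
    shift (shift^ d (𝓔 b Y ⊕ ι d ⊛ Y) ⊕ shift^ d Y) n
      ≈⟨ shift-cong (≋-sym (shift^-⊕ d _ Y)) n ⟩
    shift (shift^ d ((𝓔 b Y ⊕ ι d ⊛ Y) ⊕ Y)) n
      ≈⟨ shift-cong (shift^-cong d (λ m → absorb (𝓔 b Y m) (ι d) (Y m))) n ⟩
    shift (shift^ d (𝓔 b Y ⊕ ι (1+ d) ⊛ Y)) n ∎
    where
    reassoc : ∀ b x → b + (1# + x) ≈ (b + x) + 1#
    reassoc = solve 2 (λ b x → b :+ (con (+ 1) :+ x) := (b :+ x) :+ con (+ 1)) refl
    absorb : ∀ e x y → (e + x * y) + y ≈ e + (1# + x) * y
    absorb = solve 3 (λ e x y → (e :+ x :* y) :+ y := e :+ (con (+ 1) :+ x) :* y) refl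

  𝓔-[1-x] : ∀ b Y → 𝓔 (b + 1#) ([1-x] Y) ≋ [1-x] (𝓔 b Y)
  𝓔-[1-x] b Y zero = at0 (Y 0) b
    where
    at0 : ∀ y b → (0# * (y - 0#) - 0#) + (b + 1#) * 0# ≈ ((0# * y - 0#) + b * 0#) - 0#
    at0 = solve 2 (λ y b → (con (+ 0) :* (y :- con (+ 0)) :- con (+ 0)) :+ (b :+ con (+ 1)) :* con (+ 0)
                     := ((con (+ 0) :* y :- con (+ 0)) :+ b :* con (+ 0)) :- con (+ 0)) refl
  𝓔-[1-x] b Y (1+ zero) = at1 (Y 1) (Y 0) b
    where
    at1 : ∀ y₁ y₀ b → ((1# + 0#) * (y₁ - y₀) - 0# * (y₀ - 0#)) + (b + 1#) * (y₀ - 0#)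
                      ≈ (((1# + 0#) * y₁ - 0# * y₀) + b * y₀) - ((0# * y₀ - 0#) + b * 0#)
    at1 = solve 3 (λ y₁ y₀ b → ((con (+ 1) :+ con (+ 0)) :* (y₁ :- y₀) :- con (+ 0) :* (y₀ :- con (+ 0)))
                                 :+ (b :+ con (+ 1)) :* (y₀ :- con (+ 0))
                     := (((con (+ 1) :+ con (+ 0)) :* y₁ :- con (+ 0) :* y₀) :+ b :* y₀)
                          :- ((con (+ 0) :* y₀ :- con (+ 0)) :+ b :* con (+ 0))) refl
  𝓔-[1-x] b Y (1+ (1+ k)) = step (ι k) (Y (1+ (1+ k))) (Y (1+ k)) (Y k) b
    where
    step : ∀ x y₂ y₁ y₀ b → ((1# + (1# + x)) * (y₂ - y₁) - (1# + x) * (y₁ - y₀)) + (b + 1#) * (y₁ - y₀)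
                      ≈ (((1# + (1# + x)) * y₂ - (1# + x) * y₁) + b * y₁) - (((1# + x) * y₁ - x * y₀) + b * y₀)
    step = solve 5 (λ x y₂ y₁ y₀ b → ((con (+ 1) :+ (con (+ 1) :+ x)) :* (y₂ :- y₁) :- (con (+ 1) :+ x) :* (y₁ :- y₀))
                                       :+ (b :+ con (+ 1)) :* (y₁ :- y₀)
                     := (((con (+ 1) :+ (con (+ 1) :+ x)) :* y₂ :- (con (+ 1) :+ x) :* y₁) :+ b :* y₁)
                          :- (((con (+ 1) :+ x) :* y₁ :- x :* y₀) :+ b :* y₀)) refl

  -- Constants are killed by θ, hence by 𝓔_0.
  𝓔-𝟙 : 𝓔 0# 𝟙 ≋ 𝟘
  𝓔-𝟙 n = trans (+-cong ([1-x]-𝟘 θ𝟙≋𝟘 n) (zeroˡ _)) (+-identityʳ 0#)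
    where
    θ𝟙≋𝟘 : θ 𝟙 ≋ 𝟘
    θ𝟙≋𝟘 zero = zeroˡ 1#
    θ𝟙≋𝟘 (1+ n) = zeroʳ _

  binomial-constant : ∀ a → oneMinusXPow a 0 ≈ 1#
  binomial-constant a = trans (*-identityˡ _) (trans (*-identityˡ _) inverse-of-one)
    where
    one≉0 : ¬ (1# + 0# ≈ 0#)
    one≉0 e = 0≉1 (sym (trans (sym (+-identityʳ 1#)) e))
    inverse-of-one : (1# + 0#) ⁻¹ ≈ 1#
    inverse-of-one = trans (sym (*-identityˡ _))
                       (trans (*-congʳ (sym (+-identityʳ 1#))) (⁻¹-inverse (1# + 0#) one≉0))

  -- In characteristic zero the positive integers are invertible; this is
  -- what makes the formal integral, the binomial coefficients and the
  -- uniqueness of solutions of 𝓔_b Y = Z work.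
  module CharacteristicZero (char0 : CharZero F) where

    *-cancelˡ : ∀ x {u v} → ¬ (x ≈ 0#) → x * u ≈ x * v → u ≈ v
    *-cancelˡ x {u} {v} x≉0 e = begin
      u                   ≈⟨ sym (*-identityˡ u) ⟩
      1# * u              ≈⟨ *-congʳ (sym x⁻¹x≈1) ⟩
      (x ⁻¹ * x) * u      ≈⟨ *-assoc _ _ _ ⟩
      x ⁻¹ * (x * u)      ≈⟨ *-congˡ e ⟩
      x ⁻¹ * (x * v)      ≈⟨ sym (*-assoc _ _ _) ⟩
      (x ⁻¹ * x) * v      ≈⟨ *-congʳ x⁻¹x≈1 ⟩
      1# * v              ≈⟨ *-identityˡ v ⟩
      v                   ∎
      where
      x⁻¹x≈1 : x ⁻¹ * x ≈ 1#
      x⁻¹x≈1 = trans (*-comm _ _) (⁻¹-inverse x x≉0)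

    fact-nonzero : ∀ n → ¬ (fact n ≈ 0#)
    fact-nonzero n = nonzero (n ℕ.!) {{ℕP._!≢0 n}}
      where
      nonzero : ∀ m → .{{ℕ.NonZero m}} → ¬ (ι m ≈ 0#)
      nonzero (1+ k) = char0 k

    fact-step : ∀ n → ι (1+ n) * fact (1+ n) ⁻¹ ≈ fact n ⁻¹
    fact-step n = *-cancelˡ (fact n) (fact-nonzero n) (begin
      fact n * (ι (1+ n) * fact (1+ n) ⁻¹)   ≈⟨ sym (*-assoc _ _ _) ⟩
      (fact n * ι (1+ n)) * fact (1+ n) ⁻¹   ≈⟨ *-congʳ (trans (*-comm _ _) (sym (ι-* (1+ n) (n ℕ.!)))) ⟩
      fact (1+ n) * fact (1+ n) ⁻¹           ≈⟨ ⁻¹-inverse _ (fact-nonzero (1+ n)) ⟩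
      1#                                     ≈⟨ sym (⁻¹-inverse _ (fact-nonzero n)) ⟩
      fact n * fact n ⁻¹                     ∎)

    -- A solution of 𝓔_b Y = Z is determined by its constant term, since
    -- (n+1) Y_{n+1} = Z_{n+1} + n Y_n - b Y_n.
    𝓔-injective : ∀ b Y Z → 𝓔 b Y ≋ 𝓔 b Z → Y 0 ≈ Z 0 → Y ≋ Z
    𝓔-injective b Y Z e e₀ zero = e₀
    𝓔-injective b Y Z e e₀ (1+ m) = *-cancelˡ (ι (1+ m)) (char0 m) (begin
      ι (1+ m) * Y (1+ m)                                ≈⟨ solveFor _ (ι m * Y m) (b * Y m) ⟩
      ((ι (1+ m) * Y (1+ m) - ι m * Y m + b * Y m) - b * Y m) + ι m * Y m
                                                         ≈⟨ +-cong (+-cong (e (1+ m)) (-‿cong (*-congˡ IH))) (*-congˡ IH) ⟩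
      ((ι (1+ m) * Z (1+ m) - ι m * Z m + b * Z m) - b * Z m) + ι m * Z m
                                                         ≈⟨ sym (solveFor _ _ _) ⟩
      ι (1+ m) * Z (1+ m)                                ∎)
      where
      IH : Y m ≈ Z m
      IH = 𝓔-injective b Y Z e e₀ m
      solveFor : ∀ u v w → u ≈ ((u - v + w) - w) + v
      solveFor = solve 3 (λ u v w → u := ((u :- v :+ w) :- w) :+ v) refl

    θ-integral : ∀ g → θ (integral g) ≋ shift g
    θ-integral g zero = zeroˡ 0#
    θ-integral g (1+ m) = begin
      ι (1+ m) * (g m * ι (1+ m) ⁻¹)   ≈⟨ x∙yz≈y∙xz _ _ _ ⟩
      g m * (ι (1+ m) * ι (1+ m) ⁻¹)   ≈⟨ *-congˡ (⁻¹-inverse _ (char0 m)) ⟩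
      g m * 1#                         ≈⟨ *-identityʳ _ ⟩
      g m                              ∎

    -- (1 - x)^a solves 𝓔_a Y = 0: with C_n = (-1)^n a(a-1)⋯(a-n+1)/n!,
    -- (n+1) C_{n+1} = -(a - n) C_n.
    𝓔-binomial : ∀ a → 𝓔 a (oneMinusXPow a) ≋ 𝟘
    𝓔-binomial a zero = at0 _ a
      where
      at0 : ∀ y a → (0# * y - 0#) + a * 0# ≈ 0#
      at0 = solve 2 (λ y a → (con (+ 0) :* y :- con (+ 0)) :+ a :* con (+ 0) := con (+ 0)) refl
    𝓔-binomial a (1+ m) =
      trans (+-congʳ (+-congʳ (trans (regroup _ _ _ _ _ _) (*-congˡ (fact-step m))))) (cancel _ _ _ a _)
      where
      regroup : ∀ t u s φ x a → t * (- s * ((φ * (a - x)) * u)) ≈ - s * (φ * (a - x)) * (t * u)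
      regroup = solve 6 (λ t u s φ x a → t :* (:- s :* ((φ :* (a :- x)) :* u))
                           := :- s :* (φ :* (a :- x)) :* (t :* u)) refl
      cancel : ∀ s φ x a w → ((- s * (φ * (a - x)) * w) - x * (s * (φ * w))) + a * (s * (φ * w)) ≈ 0#
      cancel = solve 5 (λ s φ x a w → ((:- s :* (φ :* (a :- x)) :* w) :- x :* (s :* (φ :* w)))
                           :+ a :* (s :* (φ :* w)) := con (+ 0)) refl

    -- (1 - x)^α · (1 - x)(1 - x)^β = 1 whenever α + β + 1 = 0: both sides are
    -- killed by 𝓔_0 and have constant term 1.
    binomial-inverse : ∀ α β → α + (β + 1#) ≈ 0# → (oneMinusXPow α · [1-x] (oneMinusXPow β)) ≋ 𝟙
    binomial-inverse α β α+β+1≈0 = 𝓔-injective 0# (A · [1-x] B) 𝟙 (≋-trans killed (≋-sym 𝓔-𝟙)) constant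
      where
      A = oneMinusXPow α
      B = oneMinusXPow β
      killed : 𝓔 0# (A · [1-x] B) ≋ 𝟘
      killed n = begin
        𝓔 0# (A · [1-x] B) n                                 ≈⟨ 𝓔-congˡ (A · [1-x] B) (sym α+β+1≈0) n ⟩
        𝓔 (α + (β + 1#)) (A · [1-x] B) n                     ≈⟨ 𝓔-Leibniz α (β + 1#) A ([1-x] B) n ⟩
        (𝓔 α A · [1-x] B) n + (A · 𝓔 (β + 1#) ([1-x] B)) n   ≈⟨ +-cong (·-zeroˡ ([1-x] B) (𝓔-binomial α) n)
                                                                       (·-zeroʳ A 𝓔[1-x]B≋𝟘 n) ⟩
        0# + 0#                                              ≈⟨ +-identityʳ 0# ⟩
        0#                                                   ∎
        where
        𝓔[1-x]B≋𝟘 : 𝓔 (β + 1#) ([1-x] B) ≋ 𝟘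
        𝓔[1-x]B≋𝟘 = ≋-trans (𝓔-[1-x] β B) ([1-x]-𝟘 (𝓔-binomial β))
      constant : (A · [1-x] B) 0 ≈ 1#
      constant = trans (+-identityˡ _)
        (trans (*-cong (binomial-constant α) (trans (+-congˡ -0#≈0#) (trans (+-identityʳ _) (binomial-constant β))))
               (*-identityˡ 1#))

module HypergeometricSum {c ℓ : Level} (F : Field c ℓ) (char0 : CharZero F)
                         (p : Field.Carrier F) (f : ℕ → Field.Carrier F) (d : ℕ) where
  open PowerSeries F
  open SeriesAlgebra F
  open CharacteristicZero char0
  open IntegerCoefficients commutativeRing using (solve; _:=_; _:+_; _:*_; _:-_; :-_; con)
  open import Relation.Binary.Reasoning.Setoid setoid

  g : ℕ → Carrier
  g n = (poch p n / fact (n +ℕ d)) * sum1to f n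

  G : PS
  G = seriesFrom1 g

  H : PS
  H = seriesFrom1 (λ n → (poch p n / fact ((n +ℕ d) ∸ 1)) * f n)

  G≋g : ∀ n → G n ≈ g n
  G≋g zero = sym (zeroʳ _)
  G≋g (1+ n) = refl

  -- The recurrence (n+1+d) g_{n+1} - (n+p) g_n = h_{n+1}, i.e. 𝓔_{-p} G + d G = H.
  recurrence : (𝓔 (- p) G ⊕ ι d ⊛ G) ≋ H
  recurrence zero = at0 p (ι d)
    where
    at0 : ∀ p y → ((0# * 0# - 0#) + - p * 0#) + y * 0# ≈ 0#
    at0 = solve 2 (λ p y → ((con (+ 0) :* con (+ 0) :- con (+ 0)) :+ :- p :* con (+ 0)) :+ y :* con (+ 0)
                     := con (+ 0)) refl
  recurrence (1+ n) = begin
    ((ι (1+ n) * g (1+ n) - ι n * G n) + - p * G n) + ι d * g (1+ n)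
      ≈⟨ +-congʳ (+-cong (+-congˡ (-‿cong (*-congˡ (G≋g n)))) (*-congˡ (G≋g n))) ⟩
    ((ι (1+ n) * g (1+ n) - ι n * g n) + - p * g n) + ι d * g (1+ n)
      ≈⟨ regroup (ι n) (ι d) p (poch p n) (fact (1+ (n +ℕ d)) ⁻¹) (fact (n +ℕ d) ⁻¹) (sum1to f n) (f (1+ n)) ⟩
    ((ι (1+ n) + ι d) * fact (1+ (n +ℕ d)) ⁻¹) * ((poch p n * (p + ι n)) * (sum1to f n + f (1+ n)))
      - (ι n + p) * g n
      ≈⟨ +-congʳ (*-congʳ (trans (*-congʳ (sym (ι-+ (1+ n) d))) (fact-step (n +ℕ d)))) ⟩
    fact (n +ℕ d) ⁻¹ * ((poch p n * (p + ι n)) * (sum1to f n + f (1+ n))) - (ι n + p) * g n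
      ≈⟨ telescope (ι n) p (poch p n) (fact (n +ℕ d) ⁻¹) (sum1to f n) (f (1+ n)) ⟩
    H (1+ n) ∎
    where
    regroup : ∀ x y p P W w S φ →
      (((1# + x) * (((P * (p + x)) * W) * (S + φ)) - x * ((P * w) * S)) + - p * ((P * w) * S))
        + y * (((P * (p + x)) * W) * (S + φ))
      ≈ (((1# + x) + y) * W) * ((P * (p + x)) * (S + φ)) - (x + p) * ((P * w) * S)
    regroup = solve 8 (λ x y p P W w S φ →
      (((con (+ 1) :+ x) :* (((P :* (p :+ x)) :* W) :* (S :+ φ)) :- x :* ((P :* w) :* S)) :+ :- p :* ((P :* w) :* S))
        :+ y :* (((P :* (p :+ x)) :* W) :* (S :+ φ))
      := (((con (+ 1) :+ x) :+ y) :* W) :* ((P :* (p :+ x)) :* (S :+ φ)) :- (x :+ p) :* ((P :* w) :* S)) refl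
    telescope : ∀ x p P w S φ →
      w * ((P * (p + x)) * (S + φ)) - (x + p) * ((P * w) * S) ≈ ((P * (p + x)) * w) * φ
    telescope = solve 6 (λ x p P w S φ →
      w :* ((P :* (p :+ x)) :* (S :+ φ)) :- (x :+ p) :* ((P :* w) :* S) := ((P :* (p :+ x)) :* w) :* φ) refl

  𝓔-xᵈG : 𝓔 (ι d - p) (shift^ d G) ≋ shift^ d H
  𝓔-xᵈG n = trans (𝓔-congˡ (shift^ d G) (+-comm (ι d) (- p)) n)
                  (trans (𝓔-shift^ (- p) d G n) (shift^-cong d recurrence n))

  α β : Carrier
  α = ι d - p
  β = (p - ι d) - 1#

  A B I Q : PS
  A = oneMinusXPow α
  B = oneMinusXPow β
  I = integral (mulXPowPred d (B · H))
  Q = A · I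

  -- θ I = x^d B H, using that B H has no constant term
  θI : θ I ≋ shift^ d (B · H)
  θI n = begin
    θ I n                                       ≈⟨ θ-integral (mulXPowPred d (B · H)) n ⟩
    shift (mulXPow d (divXPow 1 (B · H))) n     ≈⟨ shift-cong (mulXPow≋shift^ d _) n ⟩
    shift (shift^ d (divXPow 1 (B · H))) n      ≈⟨ sym (shift^-shift d _ n) ⟩
    shift^ d (shift (divXPow 1 (B · H))) n      ≈⟨ shift^-cong d (shift-divX (B · H) (trans (+-identityˡ _) (zeroʳ _))) n ⟩
    shift^ d (B · H) n                          ∎

  𝓔₀I : 𝓔 0# I ≋ shift^ d ([1-x] B · H)
  𝓔₀I n = begin
    [1-x] (θ I) n + 0# * shift I n    ≈⟨ +-cong ([1-x]-cong θI n) (zeroˡ _) ⟩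
    [1-x] (shift^ d (B · H)) n + 0#   ≈⟨ +-identityʳ _ ⟩
    [1-x] (shift^ d (B · H)) n        ≈⟨ [1-x]-shift^ d (B · H) n ⟩
    shift^ d ([1-x] (B · H)) n        ≈⟨ shift^-cong d (≋-sym ([1-x]-·ˡ B H)) n ⟩
    shift^ d ([1-x] B · H) n          ∎

  𝓔-Q : 𝓔 α Q ≋ shift^ d H
  𝓔-Q n = begin
    𝓔 α Q n                                      ≈⟨ 𝓔-congˡ Q (sym (+-identityʳ α)) n ⟩
    𝓔 (α + 0#) Q n                               ≈⟨ 𝓔-Leibniz α 0# A I n ⟩
    (𝓔 α A · I) n + (A · 𝓔 0# I) n               ≈⟨ +-cong (·-zeroˡ I (𝓔-binomial α) n) (·-congʳ A 𝓔₀I n) ⟩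
    0# + (A · shift^ d ([1-x] B · H)) n           ≈⟨ +-identityˡ _ ⟩
    (A · shift^ d ([1-x] B · H)) n                ≈⟨ ·-shift^ʳ d A ([1-x] B · H) n ⟩
    shift^ d (A · ([1-x] B · H)) n                ≈⟨ shift^-cong d (≋-sym (·-assoc A ([1-x] B) H)) n ⟩
    shift^ d ((A · [1-x] B) · H) n                ≈⟨ shift^-cong d (·-congˡ H (binomial-inverse α β α+β+1≈0)) n ⟩
    shift^ d (𝟙 · H) n                            ≈⟨ shift^-cong d (·-identityˡ H) n ⟩
    shift^ d H n                                  ∎
    where
    α+β+1≈0 : α + (β + 1#) ≈ 0#
    α+β+1≈0 = solve 2 (λ y p → (y :- p) :+ (((p :- y) :- con (+ 1)) :+ con (+ 1)) := con (+ 0)) refl (ι d) p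

  -- Both Q and x^d G solve 𝓔_α Y = x^d H with Y_0 = 0.
  Q≋xᵈG : Q ≋ shift^ d G
  Q≋xᵈG = 𝓔-injective α Q (shift^ d G) (≋-trans 𝓔-Q (≋-sym 𝓔-xᵈG))
            (trans (trans (+-identityˡ _) (zeroʳ _)) (sym (shift^-constant d refl)))

lemma3 : {c ℓ : Level} (F : Field c ℓ) → CharZero F →
    let open PowerSeries F in
    (p : Carrier) (f : ℕ → Carrier) (d : ℕ) →
    seriesFrom1 (λ n → (poch p n / fact (n +ℕ d)) * sum1to f n)
      ≋ divXPow d
          (oneMinusXPow (ι d - p)
            · integral
                (mulXPowPred d
                  (oneMinusXPow ((p - ι d) - 1#)
                    · seriesFrom1 (λ n → (poch p n / fact ((n +ℕ d) ∸ 1)) * f n))))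
lemma3 F char0 p f d n = begin
  G n                     ≡⟨ P.sym (shift^-at d G n) ⟩
  shift^ d G (d +ℕ n)     ≈⟨ sym (Q≋xᵈG (d +ℕ n)) ⟩
  Q (d +ℕ n)              ≡⟨ P.cong Q (ℕP.+-comm d n) ⟩
  Q (n +ℕ d)              ∎
  where
  open PowerSeries F
  open SeriesAlgebra F using (shift^; shift^-at)
  open HypergeometricSum F char0 p f d using (G; Q; Q≋xᵈG)
  open import Relation.Binary.Reasoning.Setoid setoid
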